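{- Let $G$ be a graph with $n$ vertices and $m$ edges, and let $t$ be a positive number. Then $$Sdyn_t(G)=P\beta_{nt-m}(G).$$
   Context: Graphs are finite, simple and undirected. A threshold assignment for $G$ is a map $\tau:V(G)\to\mathbb{N}\cup\{0\}$ with $0\le\tau(v)\le d_G(v)$ for every $v$; its average is $\bar\tau=\sum_v\tau(v)/|V(G)|$. A set $D\subseteq V(G)$ is a $\tau$-dynamic monopoly if for some nonnegative integer $k$, $V(G)$ can be partitioned into $D_0,D_1,\dots,D_k$ with $D_0=D$ and, for each $1\le i\le k$, $D_i$ consists of all vertices $v$ (not already in $D_0\cup\dots\cup D_{i-1}$) having at least $\tau(v)$ neighbors in $D_0\cup\dots\cup D_{i-1}$. $dyn_\tau(G)$ is the minimum size of a $\tau$-dynamic monopoly, and $Sdyn_t(G)=\min\{dyn_\tau(G): \bar\tau\ge t\}$. For a real number $s$, $P\beta_s(G)$ is the minimum size of a set $S\subseteq V(G)$ such that at least $s$ edges of $G$ have an endpoint in $S$.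
   Formalization: The positive number t ranges over the positive rationals. -}

module Defs where

open import Data.Nat as ℕ using (ℕ; zero; suc; NonZero)
open import Data.Integer using (+_)
open import Data.Rational as ℚ using (ℚ)
open import Data.Bool using (Bool; true; false; _∧_; _∨_; if_then_else_)
open import Data.Fin using (Fin; toℕ)
open import Data.Fin.Subset using (Subset; _∈_; _∉_; _∩_; _∪_; ∣_∣)
open import Data.Vec using (tabulate)
open import Data.List using (List; map; allFin)
open import Data.Nat.ListAction using (sum)
open import Data.Product using (Σ; ∃; ∃-syntax; _×_)
open import Relation.Binary.PropositionalEquality using (_≡_)
open import Function.Bundles using (_⇔_)

record Graph (n : ℕ) : Set where
  field
    adj    : Fin n → Fin n → Bool
    sym    : ∀ u v → adj u v ≡ adj v u
    irrefl : ∀ v → adj v v ≡ false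
open Graph public

Σv : ∀ {n} → (Fin n → ℕ) → ℕ
Σv {n} f = sum (map f (allFin n))

b2n : Bool → ℕ
b2n b = if b then 1 else 0

N : ∀ {n} → Graph n → Fin n → Subset n
N G v = tabulate (adj G v)

deg : ∀ {n} → Graph n → Fin n → ℕ
deg G v = ∣ N G v ∣

edgesWith : ∀ {n} → Graph n → (Fin n → Fin n → Bool) → ℕ
edgesWith G P =
  Σv (λ u → Σv (λ v → b2n ((toℕ u ℕ.<ᵇ toℕ v) ∧ adj G u v ∧ P u v)))

edges : ∀ {n} → Graph n → ℕ
edges G = edgesWith G (λ _ _ → true)

coveredEdges : ∀ {n} → Graph n → Subset n → ℕ
coveredEdges G S = edgesWith G (λ u v → Data.Vec.lookup S u ∨ Data.Vec.lookup S v)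
  where import Data.Vec

IsThreshold : ∀ {n} → Graph n → (Fin n → ℕ) → Set
IsThreshold G τ = ∀ v → τ v ℕ.≤ deg G v

average : ∀ {n} → .{{NonZero n}} → (Fin n → ℕ) → ℚ
average {n} τ = (+ Σv τ) ℚ./ n

ℕtoℚ : ℕ → ℚ
ℕtoℚ k = (+ k) ℚ./ 1

upto : ∀ {n} → (ℕ → Subset n) → ℕ → Subset n
upto Ds zero    = Ds zero
upto Ds (suc j) = upto Ds j ∪ Ds (suc j)

-- D is a τ-dynamic monopoly: there are k and D₀ = D, D₁, …, D_k partitioning V(G)
-- with D_i = { v ∉ D₀ ∪ … ∪ D_{i-1} : v has ≥ τ(v) neighbours in D₀ ∪ … ∪ D_{i-1} }.
-- (The D_i for i ≥ 1 are disjoint from earlier parts by definition, so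
--  "partition" amounts to covering V(G).)
IsDynMono : ∀ {n} → Graph n → (Fin n → ℕ) → Subset n → Set
IsDynMono {n} G τ D =
  ∃[ k ] ∃[ Ds ] (Ds 0 ≡ D)
    × (∀ i → i ℕ.< k → ∀ v →
         (v ∈ Ds (suc i)) ⇔ ((v ∉ upto Ds i) × (τ v ℕ.≤ ∣ N G v ∩ upto Ds i ∣)))
    × (∀ v → ∃[ i ] (i ℕ.≤ k × v ∈ Ds i))

IsMinimum : (ℕ → Set) → ℕ → Set
IsMinimum P k = P k × (∀ j → P j → k ℕ.≤ j)

IsDyn : ∀ {n} → Graph n → (Fin n → ℕ) → ℕ → Set
IsDyn G τ = IsMinimum (λ j → ∃[ D ] (∣ D ∣ ≡ j × IsDynMono G τ D))

IsSdyn : ∀ {n} → .{{NonZero n}} → Graph n → ℚ → ℕ → Set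
IsSdyn G t = IsMinimum (λ j → ∃[ τ ] (IsThreshold G τ × t ℚ.≤ average τ × IsDyn G τ j))

IsPβ : ∀ {n} → Graph n → ℚ → ℕ → Set
IsPβ G s = IsMinimum (λ j → ∃[ S ] (∣ S ∣ ≡ j × s ℚ.≤ ℕtoℚ (coveredEdges G S)))

{-# OPTIONS --safe #-}

-- If D is a τ-dynamic monopoly, a vertex of D has τ(v) ≤ deg v, and a vertex activated in
-- round i + 1 has at least τ(v) neighbours activated in earlier rounds.  Charging τ(v) to these
-- edges, an edge is charged at most once unless it meets D, in which case at most twice; so
-- Σ τ ≤ m + (number of edges meeting D), and τ̄ ≥ t forces D to cover at least nt − m edges.
-- Conversely, list a set S first and the remaining vertices after it by index, and let τ_S(v)
-- count the neighbours of v listed before v (all of them when v ∈ S).  Then S activates every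
-- vertex in that order, and Σ τ_S = m + (number of edges meeting S), because such an edge is
-- counted from both ends and any other edge only from its later end.  So the sets covering at
-- least nt − m edges are exactly the τ-dynamic monopolies for the various τ with τ̄ ≥ t, and the
-- two minima agree.

module Submission where

open import Defs
open import Data.Nat using (ℕ; NonZero)
open import Data.Rational using (ℚ; Positive; _*_; _-_)
open import Function.Bundles using (_⇔_)

open import Data.Bool using (Bool; true; false; T; _∧_; _∨_; if_then_else_)
open import Data.Bool.Properties using (T-∨; T-≡)
open import Data.Empty using (⊥-elim)
open import Data.Fin using (Fin; zero; suc; toℕ)
open import Data.Fin.Properties using (toℕ-injective; toℕ<n)
open import Data.Fin.Subset using (Subset; _∈_; _∉_; _⊆_; _∩_; _∪_; ∣_∣)
open import Data.Fin.Subset.Properties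
  using (_∈?_; anySubset?; p⊆q⇒∣p∣≤∣q∣; p⊆p∪q; q⊆p∪q; x∈p∩q⁺; x∈p∩q⁻; x∈p∪q⁻; ∣p∩q∣≤∣p∣)
open import Data.List using (List; []; _∷_; map; allFin)
open import Data.List.Properties using (map-cong; map-tabulate)
open import Data.Nat
  using (zero; suc; _+_; _≤_; _<_; _≟_; _≤′_; ≤′-refl; ≤′-step; _<ᵇ_; z≤n; s≤s; _≤?_)
open import Data.Nat.Induction using (<-rec)
open import Data.Nat.ListAction using (sum)
open import Data.Nat.Properties
  using ( ≤-refl; ≤-trans; ≤-pred; ≤-antisym; ≰⇒>; ≮⇒≥; <-asym; m≤n⇒m≤1+n; m<1+n⇒m<n∨m≡n
        ; ≤⇒≤′; <⇒<ᵇ; <ᵇ⇒<; <ᵇ-reflects-<; +-comm; +-identityʳ; +-mono-≤; +-monoˡ-≤; m≤n+m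
        ; anyUpTo?; +-commutativeSemigroup; module ≤-Reasoning)
open import Algebra.Properties.CommutativeSemigroup +-commutativeSemigroup using (interchange)
open import Data.Product using (∃; ∃-syntax; _×_; _,_; proj₁; proj₂)
open import Data.Sum using (inj₁; inj₂)
open import Data.Vec using ([]; _∷_; lookup; tabulate)
open import Data.Vec.Properties using (lookup∘tabulate; lookup-zipWith; []=⇒lookup; lookup⇒[]=)
open import Function using (_∘_; id)
open import Function.Bundles using (Equivalence; mk⇔)
open import Relation.Binary.PropositionalEquality as ≡
  using (_≡_; refl; trans; cong; cong₂; subst; _≗_; module ≡-Reasoning)
open import Relation.Nullary using (Dec; yes; no; contradiction; isYes)
open import Relation.Nullary.Reflects using (Reflects; ofʸ; ofⁿ)
open import Relation.Nullary.Decidable using (¬?; _×-dec_; toWitness; fromWitness)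
open import Relation.Unary using (Decidable)
import Data.Integer as ℤ
import Data.Integer.Properties as ℤ
import Data.Rational as ℚ
import Data.Rational.Properties as ℚ
import Data.Rational.Unnormalised as ℚᵘ
import Data.Rational.Unnormalised.Properties as ℚᵘ
open import Algebra.Properties.Group ℚ.+-0-group using (//-rightDividesˡ; //-rightDividesʳ)

b2n≤1 : ∀ b → b2n b ≤ 1
b2n≤1 true  = ≤-refl
b2n≤1 false = z≤n

sum-map-+ : ∀ {A : Set} (f g : A → ℕ) (xs : List A) →
            sum (map (λ x → f x + g x) xs) ≡ sum (map f xs) + sum (map g xs)
sum-map-+ f g []       = refl
sum-map-+ f g (x ∷ xs) = begin
  (f x + g x) + sum (map (λ x → f x + g x) xs)    ≡⟨ cong (f x + g x +_) (sum-map-+ f g xs) ⟩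
  (f x + g x) + (sum (map f xs) + sum (map g xs)) ≡⟨ interchange (f x) (g x) _ _ ⟩
  (f x + sum (map f xs)) + (g x + sum (map g xs)) ∎
  where open ≡-Reasoning

sum-map-cong : ∀ {A : Set} {f g : A → ℕ} → f ≗ g → ∀ xs → sum (map f xs) ≡ sum (map g xs)
sum-map-cong f≗g xs = cong sum (map-cong f≗g xs)

sum-map-mono-≤ : ∀ {A : Set} {f g : A → ℕ} → (∀ x → f x ≤ g x) → ∀ xs → sum (map f xs) ≤ sum (map g xs)
sum-map-mono-≤ f≤g []       = z≤n
sum-map-mono-≤ f≤g (x ∷ xs) = +-mono-≤ (f≤g x) (sum-map-mono-≤ f≤g xs)

sum-map-zero : ∀ {A : Set} (xs : List A) → sum (map (λ _ → 0) xs) ≡ 0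
sum-map-zero []       = refl
sum-map-zero (_ ∷ xs) = sum-map-zero xs

sum-map-swap : ∀ {A B : Set} (h : A → B → ℕ) xs ys →
               sum (map (λ x → sum (map (h x) ys)) xs) ≡ sum (map (λ y → sum (map (λ x → h x y) xs)) ys)
sum-map-swap h []       ys = ≡.sym (sum-map-zero ys)
sum-map-swap h (x ∷ xs) ys = begin
  sum (map (h x) ys) + sum (map (λ x → sum (map (h x) ys)) xs)
    ≡⟨ cong (sum (map (h x) ys) +_) (sum-map-swap h xs ys) ⟩
  sum (map (h x) ys) + sum (map (λ y → sum (map (λ x → h x y) xs)) ys)
    ≡⟨ ≡.sym (sum-map-+ (h x) (λ y → sum (map (λ x → h x y) xs)) ys) ⟩
  sum (map (λ y → h x y + sum (map (λ x → h x y) xs)) ys) ∎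
  where open ≡-Reasoning

Σv-suc : ∀ {n} (f : Fin (suc n) → ℕ) → Σv f ≡ f zero + Σv (f ∘ suc)
Σv-suc f = cong (λ xs → f zero + sum xs) (trans (map-tabulate suc f) (≡.sym (map-tabulate id (f ∘ suc))))

∣p∣≡Σv : ∀ {n} (p : Subset n) → ∣ p ∣ ≡ Σv (b2n ∘ lookup p)
∣p∣≡Σv []          = refl
∣p∣≡Σv (true  ∷ p) = trans (cong suc (∣p∣≡Σv p)) (≡.sym (Σv-suc (b2n ∘ lookup (true ∷ p))))
∣p∣≡Σv (false ∷ p) = trans (∣p∣≡Σv p) (≡.sym (Σv-suc (b2n ∘ lookup (false ∷ p))))

∈⇔T-lookup : ∀ {n} {x : Fin n} {p : Subset n} → x ∈ p ⇔ T (lookup p x)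
∈⇔T-lookup {x = x} {p} = mk⇔
  (λ x∈p → Equivalence.from T-≡ ([]=⇒lookup x∈p))
  (λ t → lookup⇒[]= x p (Equivalence.to T-≡ t))

∈tabulate⇔ : ∀ {n} {x : Fin n} {g : Fin n → Bool} → x ∈ tabulate g ⇔ T (g x)
∈tabulate⇔ {x = x} {g} = mk⇔
  (λ x∈ → subst T (lookup∘tabulate g x) (Equivalence.to ∈⇔T-lookup x∈))
  (λ t → Equivalence.from ∈⇔T-lookup (subst T (≡.sym (lookup∘tabulate g x)) t))

∩-monoʳ-⊆ : ∀ {n} (p : Subset n) {q r : Subset n} → q ⊆ r → p ∩ q ⊆ p ∩ r
∩-monoʳ-⊆ p q⊆r x∈p∩q with x∈p∩q⁻ p _ x∈p∩q
... | x∈p , x∈q = x∈p∩q⁺ (x∈p , q⊆r x∈q)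

upto-mono : ∀ {n} (Ds : ℕ → Subset n) {i j} → i ≤ j → upto Ds i ⊆ upto Ds j
upto-mono Ds = go ∘ ≤⇒≤′
  where
  go : ∀ {i j} → i ≤′ j → upto Ds i ⊆ upto Ds j
  go ≤′-refl        x∈ = x∈
  go (≤′-step i≤′j) x∈ = p⊆p∪q _ (go i≤′j x∈)

_≺_ : ∀ {n} → Fin n → Fin n → Bool
u ≺ v = toℕ u <ᵇ toℕ v

≺-reflects : ∀ {n} (u v : Fin n) → Reflects (toℕ u < toℕ v) (u ≺ v)
≺-reflects u v = <ᵇ-reflects-< (toℕ u) (toℕ v)

ΣΣ : ∀ {n} → (Fin n → Fin n → ℕ) → ℕ
ΣΣ g = Σv (λ u → Σv (g u))

ΣΣ-cong : ∀ {n} {f g : Fin n → Fin n → ℕ} → (∀ u v → f u v ≡ g u v) → ΣΣ f ≡ ΣΣ g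
ΣΣ-cong f≡g = sum-map-cong (λ u → sum-map-cong (f≡g u) (allFin _)) (allFin _)

ΣΣ-mono-≤ : ∀ {n} {f g : Fin n → Fin n → ℕ} → (∀ u v → f u v ≤ g u v) → ΣΣ f ≤ ΣΣ g
ΣΣ-mono-≤ f≤g = sum-map-mono-≤ (λ u → sum-map-mono-≤ (f≤g u) (allFin _)) (allFin _)

ΣΣ-+ : ∀ {n} (f g : Fin n → Fin n → ℕ) → ΣΣ (λ u v → f u v + g u v) ≡ ΣΣ f + ΣΣ g
ΣΣ-+ f g = trans (sum-map-cong (λ u → sum-map-+ (f u) (g u) (allFin _)) (allFin _))
                 (sum-map-+ (λ u → Σv (f u)) (λ u → Σv (g u)) (allFin _))

ΣΣ-transpose : ∀ {n} (g : Fin n → Fin n → ℕ) → ΣΣ g ≡ ΣΣ (λ u v → g v u)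
ΣΣ-transpose g = sum-map-swap g (allFin _) (allFin _)

if-+ : ∀ b x y → (if b then x else 0) + (if b then y else 0) ≡ (if b then x + y else 0)
if-+ true  x y = refl
if-+ false x y = refl

split-by-≺ : ∀ {n} (g : Fin n → Fin n → ℕ) → (∀ u → g u u ≡ 0) →
             ∀ u v → g u v ≡ (if u ≺ v then g u v else 0) + (if v ≺ u then g u v else 0)
split-by-≺ g diag u v with u ≺ v | ≺-reflects u v | v ≺ u | ≺-reflects v u
... | true  | ofʸ u<v | true  | ofʸ v<u = ⊥-elim (<-asym u<v v<u)
... | true  | _       | false | _       = ≡.sym (+-identityʳ (g u v))
... | false | _       | true  | _       = refl
... | false | ofⁿ u≮v | false | ofⁿ v≮u = subst (λ w → g w v ≡ 0) (≡.sym u≡v) (diag v)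
  where
  u≡v : u ≡ v
  u≡v = toℕ-injective (≤-antisym (≮⇒≥ v≮u) (≮⇒≥ u≮v))

ΣΣ-by-pairs : ∀ {n} (g : Fin n → Fin n → ℕ) → (∀ u → g u u ≡ 0) →
              ΣΣ g ≡ ΣΣ (λ u v → if u ≺ v then g u v + g v u else 0)
ΣΣ-by-pairs g diag = begin
  ΣΣ g                                ≡⟨ ΣΣ-cong (split-by-≺ g diag) ⟩
  ΣΣ (λ u v → below u v + above u v)  ≡⟨ ΣΣ-+ below above ⟩
  ΣΣ below + ΣΣ above                 ≡⟨ cong (ΣΣ below +_) (ΣΣ-transpose above) ⟩
  ΣΣ below + ΣΣ below′                ≡⟨ ≡.sym (ΣΣ-+ below below′) ⟩
  ΣΣ (λ u v → below u v + below′ u v) ≡⟨ ΣΣ-cong (λ u v → if-+ (u ≺ v) (g u v) (g v u)) ⟩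
  ΣΣ (λ u v → if u ≺ v then g u v + g v u else 0) ∎
  where
  open ≡-Reasoning
  below above below′ : Fin _ → Fin _ → ℕ
  below  u v = if u ≺ v then g u v else 0
  above  u v = if v ≺ u then g u v else 0
  below′ u v = if u ≺ v then g v u else 0

edgeSum : ∀ {n} → Graph n → (Fin n → Fin n → ℕ) → ℕ
edgeSum G w = ΣΣ (λ u v → if u ≺ v ∧ adj G u v then w u v else 0)

edgesWith≡edgeSum : ∀ {n} (G : Graph n) (P : Fin n → Fin n → Bool) →
                    edgesWith G P ≡ edgeSum G (λ u v → b2n (P u v))
edgesWith≡edgeSum G P = ΣΣ-cong (λ u v → b2n-∧∧ (u ≺ v) (adj G u v) (P u v))
  where
  b2n-∧∧ : ∀ a b c → b2n (a ∧ b ∧ c) ≡ (if a ∧ b then b2n c else 0)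
  b2n-∧∧ true  true  c = refl
  b2n-∧∧ true  false c = refl
  b2n-∧∧ false b     c = refl

edgeSum-+ : ∀ {n} (G : Graph n) (w₁ w₂ : Fin n → Fin n → ℕ) →
            edgeSum G (λ u v → w₁ u v + w₂ u v) ≡ edgeSum G w₁ + edgeSum G w₂
edgeSum-+ G w₁ w₂ = trans (ΣΣ-cong (λ u v → ≡.sym (if-+ (edge u v) (w₁ u v) (w₂ u v))))
                           (ΣΣ-+ (λ u v → if edge u v then w₁ u v else 0)
                                 (λ u v → if edge u v then w₂ u v else 0))
  where
  edge : Fin _ → Fin _ → Bool
  edge u v = u ≺ v ∧ adj G u v

edgeSum-mono-≤ : ∀ {n} (G : Graph n) {w₁ w₂ : Fin n → Fin n → ℕ} →
                 (∀ u v → T (u ≺ v) → T (adj G u v) → w₁ u v ≤ w₂ u v) → edgeSum G w₁ ≤ edgeSum G w₂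
edgeSum-mono-≤ G {w₁} {w₂} w₁≤w₂ = ΣΣ-mono-≤ pointwise
  where
  pointwise : ∀ u v → (if u ≺ v ∧ adj G u v then w₁ u v else 0) ≤ (if u ≺ v ∧ adj G u v then w₂ u v else 0)
  pointwise u v with u ≺ v in u≺v | adj G u v in uv
  ... | true  | true  = w₁≤w₂ u v (Equivalence.from T-≡ u≺v) (Equivalence.from T-≡ uv)
  ... | true  | false = z≤n
  ... | false | _     = z≤n

edges+coveredEdges : ∀ {n} (G : Graph n) (S : Subset n) →
                     edges G + coveredEdges G S ≡ edgeSum G (λ u v → 1 + b2n (lookup S u ∨ lookup S v))
edges+coveredEdges G S =
  trans (cong₂ _+_ (edgesWith≡edgeSum G (λ _ _ → true)) (edgesWith≡edgeSum G covers))
        (≡.sym (edgeSum-+ G (λ _ _ → 1) (λ u v → b2n (covers u v))))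
  where
  covers : Fin _ → Fin _ → Bool
  covers u v = lookup S u ∨ lookup S v

∣N∩tabulate∣ : ∀ {n} (G : Graph n) v (g : Fin n → Bool) →
               ∣ N G v ∩ tabulate g ∣ ≡ Σv (λ u → b2n (adj G v u ∧ g u))
∣N∩tabulate∣ G v g = trans (∣p∣≡Σv (N G v ∩ tabulate g)) (sum-map-cong (cong b2n ∘ lookup-∩) (allFin _))
  where
  lookup-∩ : ∀ u → lookup (N G v ∩ tabulate g) u ≡ (adj G v u ∧ g u)
  lookup-∩ u = trans (lookup-zipWith _∧_ u (N G v) (tabulate g))
                     (cong₂ _∧_ (lookup∘tabulate (adj G v) u) (lookup∘tabulate g u))

handshake : ∀ {n} (G : Graph n) (F : Fin n → Fin n → Bool) →
            Σv (λ v → ∣ N G v ∩ tabulate (F v) ∣) ≡ edgeSum G (λ u v → b2n (F u v) + b2n (F v u))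
handshake G F = begin
  Σv (λ v → ∣ N G v ∩ tabulate (F v) ∣)               ≡⟨ sum-map-cong (λ v → ∣N∩tabulate∣ G v (F v)) (allFin _) ⟩
  ΣΣ arcs                                              ≡⟨ ΣΣ-by-pairs arcs loopless ⟩
  ΣΣ (λ u v → if u ≺ v then arcs u v + arcs v u else 0) ≡⟨ ΣΣ-cong orient ⟩
  edgeSum G (λ u v → b2n (F u v) + b2n (F v u))        ∎
  where
  open ≡-Reasoning
  arcs : Fin _ → Fin _ → ℕ
  arcs v u = b2n (adj G v u ∧ F v u)
  loopless : ∀ v → arcs v v ≡ 0
  loopless v = cong (λ b → b2n (b ∧ F v v)) (irrefl G v)
  by-edge : ∀ c a x y → (if c then b2n (a ∧ x) + b2n (a ∧ y) else 0) ≡ (if c ∧ a then b2n x + b2n y else 0)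
  by-edge true  true  x y = refl
  by-edge true  false x y = refl
  by-edge false a     x y = refl
  orient : ∀ u v → (if u ≺ v then arcs u v + arcs v u else 0) ≡
                   (if u ≺ v ∧ adj G u v then b2n (F u v) + b2n (F v u) else 0)
  orient u v rewrite Graph.sym G v u = by-edge (u ≺ v) (adj G u v) (F u v) (F v u)

IsActivationSequence : ∀ {n} → Graph n → (Fin n → ℕ) → ℕ → (ℕ → Subset n) → Set
IsActivationSequence G τ k Ds =
  ∀ i → i < k → ∀ v → (v ∈ Ds (suc i)) ⇔ ((v ∉ upto Ds i) × (τ v ≤ ∣ N G v ∩ upto Ds i ∣))

activation-stage-≤ : ∀ {n} {G : Graph n} {τ k Ds} → IsActivationSequence G τ k Ds →
                     ∀ {u s i} → s ≤ k → u ∈ Ds s → u ∈ upto Ds i → s ≤ i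
activation-stage-≤ steps {s = zero}      _   _    _      = z≤n
activation-stage-≤ steps {u} {suc j} {i} s≤k u∈Dₛ u∈Dsᵢ with suc j ≤? i
... | yes s≤i = s≤i
... | no  s≰i = contradiction (upto-mono _ (≤-pred (≰⇒> s≰i)) u∈Dsᵢ)
                             (proj₁ (Equivalence.to (steps j s≤k u) u∈Dₛ))

module Activation {n} (G : Graph n) (τ : Fin n → ℕ) (D : Subset n) where

  activates? : ∀ A v → Dec (v ∉ A × τ v ≤ ∣ N G v ∩ A ∣)
  activates? A v = ¬? (v ∈? A) ×-dec τ v ≤? ∣ N G v ∩ A ∣

  newlyActive : Subset n → Subset n
  newlyActive A = tabulate (isYes ∘ activates? A)

  ∈newlyActive⇔ : ∀ A v → v ∈ newlyActive A ⇔ (v ∉ A × τ v ≤ ∣ N G v ∩ A ∣)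
  ∈newlyActive⇔ A v = mk⇔ (toWitness {a? = activates? A v} ∘ Equivalence.to ∈tabulate⇔)
                          (Equivalence.from ∈tabulate⇔ ∘ fromWitness {a? = activates? A v})

  active : ℕ → Subset n
  active zero    = D
  active (suc i) = active i ∪ newlyActive (active i)

  stage : ℕ → Subset n
  stage zero    = D
  stage (suc i) = newlyActive (active i)

  upto-stage : ∀ i → upto stage i ≡ active i
  upto-stage zero    = refl
  upto-stage (suc i) = cong (_∪ newlyActive (active i)) (upto-stage i)

  D⊆active : ∀ j → D ⊆ active j
  D⊆active zero    v∈D = v∈D
  D⊆active (suc j) v∈D = p⊆p∪q _ (D⊆active j v∈D)

  ∈active⇒∈stage : ∀ {v} j → v ∈ active j → ∃[ i ] (i ≤ j × v ∈ stage i)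
  ∈active⇒∈stage zero    v∈D = 0 , z≤n , v∈D
  ∈active⇒∈stage (suc j) v∈A with x∈p∪q⁻ (active j) (newlyActive (active j)) v∈A
  ... | inj₁ v∈Aⱼ  = let i , i≤j , v∈Dᵢ = ∈active⇒∈stage j v∈Aⱼ in i , m≤n⇒m≤1+n i≤j , v∈Dᵢ
  ... | inj₂ v∈new = suc j , ≤-refl , v∈new

  active-isDynMono : ∀ k → (∀ v → v ∈ active k) → IsDynMono G τ D
  active-isDynMono k all-active = k , stage , refl , steps , λ v → ∈active⇒∈stage k (all-active v)
    where
    steps : IsActivationSequence G τ k stage
    steps i _ v rewrite upto-stage i = ∈newlyActive⇔ (active i) v

b2n-<ᵇ-asym : ∀ x y → b2n (y <ᵇ x) + b2n (x <ᵇ y) ≤ 1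
b2n-<ᵇ-asym zero    zero    = z≤n
b2n-<ᵇ-asym zero    (suc y) = ≤-refl
b2n-<ᵇ-asym (suc x) zero    = ≤-refl
b2n-<ᵇ-asym (suc x) (suc y) = b2n-<ᵇ-asym x y

at-most-one-earlier : ∀ a b x y → b2n (a ∨ (y <ᵇ x)) + b2n (b ∨ (x <ᵇ y)) ≤ 1 + b2n (a ∨ b)
at-most-one-earlier true  b     x y = s≤s (b2n≤1 (b ∨ (x <ᵇ y)))
at-most-one-earlier false true  x y = +-monoˡ-≤ 1 (b2n≤1 (y <ᵇ x))
at-most-one-earlier false false x y = b2n-<ᵇ-asym x y

Στ≤edges+coveredEdges : ∀ {n} (G : Graph n) {τ : Fin n → ℕ} {D : Subset n} →
                        IsThreshold G τ → IsDynMono G τ D → Σv τ ≤ edges G + coveredEdges G D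
Στ≤edges+coveredEdges G {τ} {D} τ≤deg (k , Ds , Ds₀≡D , steps , cover) = begin
  Σv τ                                                       ≤⟨ sum-map-mono-≤ τ≤∣earlier∣ (allFin _) ⟩
  Σv (λ v → ∣ N G v ∩ tabulate (earlier v) ∣)                ≡⟨ handshake G earlier ⟩
  edgeSum G (λ u v → b2n (earlier u v) + b2n (earlier v u)) ≤⟨ edgeSum-mono-≤ G per-edge ⟩
  edgeSum G (λ u v → 1 + b2n (lookup D u ∨ lookup D v))     ≡⟨ ≡.sym (edges+coveredEdges G D) ⟩
  edges G + coveredEdges G D                                 ∎
  where
  open ≤-Reasoning
  stage : Fin _ → ℕ
  stage v = proj₁ (cover v)
  stage-spec : ∀ v → stage v ≤ k × v ∈ Ds (stage v)
  stage-spec v = proj₂ (cover v)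
  stage-≤ : ∀ {x i} → x ∈ upto Ds i → stage x ≤ i
  stage-≤ {x} = activation-stage-≤ {G = G} {τ} steps (proj₁ (stage-spec x)) (proj₂ (stage-spec x))
  earlier : Fin _ → Fin _ → Bool
  earlier v u = lookup D v ∨ (stage u <ᵇ stage v)
  per-edge : ∀ u v → T (u ≺ v) → T (adj G u v) →
             b2n (earlier u v) + b2n (earlier v u) ≤ 1 + b2n (lookup D u ∨ lookup D v)
  per-edge u v _ _ = at-most-one-earlier (lookup D u) (lookup D v) (stage u) (stage v)
  τ≤∣earlier∣ : ∀ v → τ v ≤ ∣ N G v ∩ tabulate (earlier v) ∣
  τ≤∣earlier∣ v = at-stage (stage v) refl (stage-spec v)
    where
    at-stage : ∀ s → stage v ≡ s → s ≤ k × v ∈ Ds s → τ v ≤ ∣ N G v ∩ tabulate (earlier v) ∣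
    at-stage zero    _  (_ , v∈Ds₀) = ≤-trans (τ≤deg v) (p⊆q⇒∣p∣≤∣q∣ N⊆)
      where
      v∈D : T (lookup D v)
      v∈D = Equivalence.to ∈⇔T-lookup (subst (v ∈_) Ds₀≡D v∈Ds₀)
      N⊆ : N G v ⊆ N G v ∩ tabulate (earlier v)
      N⊆ x∈N = x∈p∩q⁺ (x∈N , Equivalence.from ∈tabulate⇔ (Equivalence.from T-∨ (inj₁ v∈D)))
    at-stage (suc j) eq (s≤k , v∈Dₛ) =
      ≤-trans (proj₂ (Equivalence.to (steps j s≤k v) v∈Dₛ)) (p⊆q⇒∣p∣≤∣q∣ (∩-monoʳ-⊆ (N G v) before⊆))
      where
      before⊆ : upto Ds j ⊆ tabulate (earlier v)
      before⊆ {x} x∈ = Equivalence.from ∈tabulate⇔ (Equivalence.from T-∨ (inj₂ (<⇒<ᵇ x<v)))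
        where
        x<v : stage x < stage v
        x<v = subst (stage x <_) (≡.sym eq) (s≤s (stage-≤ x∈))

module _ {n} (G : Graph n) (S : Subset n) where

  precedes : Fin n → Fin n → Bool
  precedes v u = (lookup S v ∨ lookup S u) ∨ (u ≺ v)

  sequentialThreshold : Fin n → ℕ
  sequentialThreshold v = ∣ N G v ∩ tabulate (precedes v) ∣

  sequentialThreshold-isThreshold : IsThreshold G sequentialThreshold
  sequentialThreshold-isThreshold v = ∣p∩q∣≤∣p∣ (N G v) (tabulate (precedes v))

  edges+coveredEdges≤Σsequential : edges G + coveredEdges G S ≤ Σv sequentialThreshold
  edges+coveredEdges≤Σsequential = begin
    edges G + coveredEdges G S                                   ≡⟨ edges+coveredEdges G S ⟩
    edgeSum G (λ u v → 1 + b2n (lookup S u ∨ lookup S v))       ≤⟨ edgeSum-mono-≤ G per-edge ⟩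
    edgeSum G (λ u v → b2n (precedes u v) + b2n (precedes v u)) ≡⟨ ≡.sym (handshake G precedes) ⟩
    Σv sequentialThreshold                                       ∎
    where
    open ≤-Reasoning
    one-precedes : ∀ a b c → 1 + b2n a ≤ b2n (a ∨ c) + b2n (b ∨ true)
    one-precedes true  true  c = ≤-refl
    one-precedes true  false c = ≤-refl
    one-precedes false true  c = m≤n+m 1 (b2n c)
    one-precedes false false c = m≤n+m 1 (b2n c)
    per-edge : ∀ u v → T (u ≺ v) → T (adj G u v) →
               1 + b2n (lookup S u ∨ lookup S v) ≤ b2n (precedes u v) + b2n (precedes v u)
    per-edge u v u≺v _ rewrite Equivalence.to T-≡ u≺v =
      one-precedes (lookup S u ∨ lookup S v) (lookup S v ∨ lookup S u) (v ≺ u)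

  sequentialThreshold-isDynMono : IsDynMono G sequentialThreshold S
  sequentialThreshold-isDynMono = active-isDynMono n (λ v → earlier⇒active n v (toℕ<n v))
    where
    open Activation G sequentialThreshold S
    earlier⇒active : ∀ j v → toℕ v < j → v ∈ active j
    earlier⇒active (suc j) v v<1+j with m<1+n⇒m<n∨m≡n v<1+j
    ... | inj₁ v<j = p⊆p∪q _ (earlier⇒active j v v<j)
    ... | inj₂ v≡j with v ∈? active j
    ...   | yes v∈A = p⊆p∪q _ v∈A
    ...   | no  v∉A = q⊆p∪q (active j) _ (Equivalence.from (∈newlyActive⇔ (active j) v) (v∉A , τ≤))
      where
      preceding⊆active : tabulate (precedes v) ⊆ active j
      preceding⊆active {x} x∈ with Equivalence.to T-∨ (Equivalence.to ∈tabulate⇔ x∈)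
      ... | inj₂ x≺v = earlier⇒active j x (subst (toℕ x <_) v≡j (<ᵇ⇒< (toℕ x) (toℕ v) x≺v))
      ... | inj₁ Sv∨Sx with Equivalence.to T-∨ Sv∨Sx
      ...   | inj₁ v∈S = contradiction (D⊆active j (Equivalence.from ∈⇔T-lookup v∈S)) v∉A
      ...   | inj₂ x∈S = D⊆active j (Equivalence.from ∈⇔T-lookup x∈S)
      τ≤ : sequentialThreshold v ≤ ∣ N G v ∩ active j ∣
      τ≤ = p⊆q⇒∣p∣≤∣q∣ (∩-monoʳ-⊆ (N G v) preceding⊆active)

toℚᵘ-ℕtoℚ : ∀ k → ℚ.toℚᵘ (ℕtoℚ k) ℚᵘ.≃ ℚᵘ.mkℚᵘ (ℤ.+ k) 0
toℚᵘ-ℕtoℚ k = ℚ.toℚᵘ-fromℚᵘ (ℚᵘ.mkℚᵘ (ℤ.+ k) 0)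

ℕtoℚ-+ : ∀ x y → ℕtoℚ (x + y) ≡ ℕtoℚ x ℚ.+ ℕtoℚ y
ℕtoℚ-+ x y = ℚ.toℚᵘ-injective toℚᵘ-+
  where
  [_] : ℕ → ℤ.ℤ
  [ k ] = ℤ.+ k ℤ.* ℤ.1ℤ
  numerators : [ x + y ] ≡ ([ x ] ℤ.+ [ y ]) ℤ.* ℤ.1ℤ
  numerators = begin
    [ x + y ]                    ≡⟨ ℤ.*-identityʳ (ℤ.+ (x + y)) ⟩
    ℤ.+ (x + y)                  ≡⟨ ℤ.pos-+ x y ⟩
    ℤ.+ x ℤ.+ ℤ.+ y              ≡⟨ cong₂ ℤ._+_ (ℤ.*-identityʳ (ℤ.+ x)) (ℤ.*-identityʳ (ℤ.+ y)) ⟨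
    [ x ] ℤ.+ [ y ]              ≡⟨ ℤ.*-identityʳ ([ x ] ℤ.+ [ y ]) ⟨
    ([ x ] ℤ.+ [ y ]) ℤ.* ℤ.1ℤ   ∎
    where open ≡-Reasoning
  toℚᵘ-+ : ℚ.toℚᵘ (ℕtoℚ (x + y)) ℚᵘ.≃ ℚ.toℚᵘ (ℕtoℚ x ℚ.+ ℕtoℚ y)
  toℚᵘ-+ = begin
    ℚ.toℚᵘ (ℕtoℚ (x + y))                     ≈⟨ toℚᵘ-ℕtoℚ (x + y) ⟩
    ℚᵘ.mkℚᵘ (ℤ.+ (x + y)) 0                    ≈⟨ ℚᵘ.*≡* numerators ⟩
    ℚᵘ.mkℚᵘ (ℤ.+ x) 0 ℚᵘ.+ ℚᵘ.mkℚᵘ (ℤ.+ y) 0   ≈⟨ ℚᵘ.+-cong (toℚᵘ-ℕtoℚ x) (toℚᵘ-ℕtoℚ y) ⟨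
    ℚ.toℚᵘ (ℕtoℚ x) ℚᵘ.+ ℚ.toℚᵘ (ℕtoℚ y)       ≈⟨ ℚ.toℚᵘ-homo-+ (ℕtoℚ x) (ℕtoℚ y) ⟨
    ℚ.toℚᵘ (ℕtoℚ x ℚ.+ ℕtoℚ y)                 ∎
    where open ℚᵘ.≃-Reasoning

ℕtoℚ*/ : ∀ a n .{{_ : NonZero n}} → ℕtoℚ n * ((ℤ.+ a) ℚ./ n) ≡ ℕtoℚ a
ℕtoℚ*/ a n@(suc d) = ℚ.toℚᵘ-injective toℚᵘ-*/
  where
  numerators : (ℤ.+ n ℤ.* ℤ.+ a) ℤ.* ℤ.1ℤ ≡ ℤ.+ a ℤ.* (ℤ.1ℤ ℤ.* ℤ.+ n)
  numerators = begin
    (ℤ.+ n ℤ.* ℤ.+ a) ℤ.* ℤ.1ℤ  ≡⟨ ℤ.*-identityʳ (ℤ.+ n ℤ.* ℤ.+ a) ⟩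
    ℤ.+ n ℤ.* ℤ.+ a             ≡⟨ ℤ.*-comm (ℤ.+ n) (ℤ.+ a) ⟩
    ℤ.+ a ℤ.* ℤ.+ n             ≡⟨ cong (ℤ.+ a ℤ.*_) (ℤ.*-identityˡ (ℤ.+ n)) ⟨
    ℤ.+ a ℤ.* (ℤ.1ℤ ℤ.* ℤ.+ n)  ∎
    where open ≡-Reasoning
  toℚᵘ-*/ : ℚ.toℚᵘ (ℕtoℚ n * ((ℤ.+ a) ℚ./ n)) ℚᵘ.≃ ℚ.toℚᵘ (ℕtoℚ a)
  toℚᵘ-*/ = begin
    ℚ.toℚᵘ (ℕtoℚ n * ((ℤ.+ a) ℚ./ n))           ≈⟨ ℚ.toℚᵘ-homo-* (ℕtoℚ n) ((ℤ.+ a) ℚ./ n) ⟩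
    ℚ.toℚᵘ (ℕtoℚ n) ℚᵘ.* ℚ.toℚᵘ ((ℤ.+ a) ℚ./ n)  ≈⟨ ℚᵘ.*-cong (toℚᵘ-ℕtoℚ n) (ℚ.toℚᵘ-fromℚᵘ (ℚᵘ.mkℚᵘ (ℤ.+ a) d)) ⟩
    ℚᵘ.mkℚᵘ (ℤ.+ n) 0 ℚᵘ.* ℚᵘ.mkℚᵘ (ℤ.+ a) d     ≈⟨ ℚᵘ.*≡* numerators ⟩
    ℚᵘ.mkℚᵘ (ℤ.+ a) 0                            ≈⟨ toℚᵘ-ℕtoℚ a ⟨
    ℚ.toℚᵘ (ℕtoℚ a)                              ∎
    where open ℚᵘ.≃-Reasoning

ℕtoℚ-mono-≤ : ∀ {x y} → x ≤ y → ℕtoℚ x ℚ.≤ ℕtoℚ y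
ℕtoℚ-mono-≤ {x} {y} x≤y = ℚ.toℚᵘ-cancel-≤ (begin
  ℚ.toℚᵘ (ℕtoℚ x)    ≃⟨ toℚᵘ-ℕtoℚ x ⟩
  ℚᵘ.mkℚᵘ (ℤ.+ x) 0  ≤⟨ ℚᵘ.*≤* (ℤ.*-monoʳ-≤-nonNeg ℤ.1ℤ (ℤ.+≤+ x≤y)) ⟩
  ℚᵘ.mkℚᵘ (ℤ.+ y) 0  ≃⟨ toℚᵘ-ℕtoℚ y ⟨
  ℚ.toℚᵘ (ℕtoℚ y)    ∎)
  where open ℚᵘ.≤-Reasoning

ℕtoℚ-positive : ∀ n .{{_ : NonZero n}} → Positive (ℕtoℚ n)
ℕtoℚ-positive (suc k) = ℚ.normalize-pos (suc k) 1

≤/⇔*≤ : ∀ n .{{_ : NonZero n}} t a → t ℚ.≤ (ℤ.+ a) ℚ./ n ⇔ ℕtoℚ n * t ℚ.≤ ℕtoℚ a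
≤/⇔*≤ n t a = mk⇔
  (λ t≤a/n → subst (ℕtoℚ n * t ℚ.≤_) (ℕtoℚ*/ a n) (ℚ.*-monoˡ-≤-nonNeg (ℕtoℚ n) {{n≥0}} t≤a/n))
  (λ nt≤a → ℚ.*-cancelˡ-≤-pos (ℕtoℚ n) {{n>0}} (subst (ℕtoℚ n * t ℚ.≤_) (≡.sym (ℕtoℚ*/ a n)) nt≤a))
  where
  n>0 : Positive (ℕtoℚ n)
  n>0 = ℕtoℚ-positive n
  n≥0 : ℚ.NonNegative (ℕtoℚ n)
  n≥0 = ℚ.pos⇒nonNeg (ℕtoℚ n) {{n>0}}

-≤⇔≤+ : ∀ p q r → p - q ℚ.≤ r ⇔ p ℚ.≤ r ℚ.+ q
-≤⇔≤+ p q r = mk⇔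
  (λ p-q≤r → subst (ℚ._≤ r ℚ.+ q) (//-rightDividesˡ q p) (ℚ.+-monoˡ-≤ q p-q≤r))
  (λ p≤r+q → subst (p - q ℚ.≤_) (//-rightDividesʳ q r) (ℚ.+-monoˡ-≤ (ℚ.- q) p≤r+q))

ℕtoℚ-+-comm : ∀ x y → ℕtoℚ (x + y) ≡ ℕtoℚ y ℚ.+ ℕtoℚ x
ℕtoℚ-+-comm x y = trans (cong ℕtoℚ (+-comm x y)) (ℕtoℚ-+ y x)

dynMono⇒nt-m≤coveredEdges : ∀ {n} .{{_ : NonZero n}} (G : Graph n) {t τ D} →
                         IsThreshold G τ → t ℚ.≤ average τ → IsDynMono G τ D →
                         ℕtoℚ n * t - ℕtoℚ (edges G) ℚ.≤ ℕtoℚ (coveredEdges G D)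
dynMono⇒nt-m≤coveredEdges {n} G {t} {τ} {D} τ≤deg t≤τ̄ dynMono =
  Equivalence.from (-≤⇔≤+ _ _ _) (begin
  ℕtoℚ n * t                                    ≤⟨ Equivalence.to (≤/⇔*≤ n t (Σv τ)) t≤τ̄ ⟩
  ℕtoℚ (Σv τ)                                   ≤⟨ ℕtoℚ-mono-≤ (Στ≤edges+coveredEdges G τ≤deg dynMono) ⟩
  ℕtoℚ (edges G + coveredEdges G D)             ≡⟨ ℕtoℚ-+-comm (edges G) (coveredEdges G D) ⟩
  ℕtoℚ (coveredEdges G D) ℚ.+ ℕtoℚ (edges G)    ∎)
  where open ℚ.≤-Reasoning

nt-m≤coveredEdges⇒t≤sequential-average : ∀ {n} .{{_ : NonZero n}} (G : Graph n) {t} S →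
                                  ℕtoℚ n * t - ℕtoℚ (edges G) ℚ.≤ ℕtoℚ (coveredEdges G S) →
                                  t ℚ.≤ average (sequentialThreshold G S)
nt-m≤coveredEdges⇒t≤sequential-average {n} G {t} S covers =
  Equivalence.from (≤/⇔*≤ n t (Σv (sequentialThreshold G S))) (begin
  ℕtoℚ n * t                                    ≤⟨ Equivalence.to (-≤⇔≤+ _ _ _) covers ⟩
  ℕtoℚ (coveredEdges G S) ℚ.+ ℕtoℚ (edges G)    ≡⟨ ℕtoℚ-+-comm (edges G) (coveredEdges G S) ⟨
  ℕtoℚ (edges G + coveredEdges G S)             ≤⟨ ℕtoℚ-mono-≤ (edges+coveredEdges≤Σsequential G S) ⟩
  ℕtoℚ (Σv (sequentialThreshold G S))           ∎)
  where open ℚ.≤-Reasoning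

minimum-exists : ∀ {Q : ℕ → Set} → Decidable Q → ∀ {j} → Q j → ∃ (IsMinimum Q)
minimum-exists {Q} Q? {j} = <-rec (λ j → Q j → ∃ (IsMinimum Q)) search j
  where
  search : ∀ j → (∀ {i} → i < j → Q i → ∃ (IsMinimum Q)) → Q j → ∃ (IsMinimum Q)
  search j smaller qj with anyUpTo? Q? j
  ... | yes (i , i<j , qi) = smaller i<j qi
  ... | no  none           = j , qj , λ i qi → ≮⇒≥ (λ i<j → none (i , i<j , qi))

IsMinimum-⇔ : ∀ {P Q : ℕ → Set} → (∀ {j} → P j → Q j) → (∀ {k} → IsMinimum Q k → P k) →
              (∀ {j} → Q j → ∃ (IsMinimum Q)) → ∀ {k} → IsMinimum P k ⇔ IsMinimum Q k
IsMinimum-⇔ P⇒Q minQ⇒P Q⇒minQ = mk⇔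
  (λ (pk , k≤P) → P⇒Q pk , λ j qj →
     let m , minQm = Q⇒minQ qj in ≤-trans (k≤P m (minQ⇒P minQm)) (proj₂ minQm j qj))
  (λ minQk@(_ , k≤Q) → minQ⇒P minQk , λ j pj → k≤Q j (P⇒Q pj))

mainTheorem7 : (n : ℕ) → .{{_ : NonZero n}} → (G : Graph n) → (t : ℚ) → Positive t →
                 (k : ℕ) → IsSdyn G t k ⇔ IsPβ G (ℕtoℚ n * t - ℕtoℚ (edges G)) k
mainTheorem7 n G t _ k =
  IsMinimum-⇔ Sdyn-witness⇒Pβ-witness Pβ-minimum⇒Sdyn-witness (minimum-exists Pβ-witness?)
  where
  s : ℚ
  s = ℕtoℚ n * t - ℕtoℚ (edges G)
  Pβ-witness? : ∀ j → Dec (∃[ S ] (∣ S ∣ ≡ j × s ℚ.≤ ℕtoℚ (coveredEdges G S)))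
  Pβ-witness? j = anySubset? (λ S → (∣ S ∣ ≟ j) ×-dec (s ℚ.≤? ℕtoℚ (coveredEdges G S)))
  Sdyn-witness⇒Pβ-witness : ∀ {j} → ∃[ τ ] (IsThreshold G τ × t ℚ.≤ average τ × IsDyn G τ j) →
                            ∃[ S ] (∣ S ∣ ≡ j × s ℚ.≤ ℕtoℚ (coveredEdges G S))
  Sdyn-witness⇒Pβ-witness (τ , τ≤deg , t≤τ̄ , (D , ∣D∣≡j , dynMono) , _) =
    D , ∣D∣≡j , dynMono⇒nt-m≤coveredEdges G τ≤deg t≤τ̄ dynMono
  Pβ-minimum⇒Sdyn-witness : ∀ {k} → IsPβ G s k → ∃[ τ ] (IsThreshold G τ × t ℚ.≤ average τ × IsDyn G τ k)
  Pβ-minimum⇒Sdyn-witness ((S , ∣S∣≡k , covers) , k≤Pβ) =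
    sequentialThreshold G S , τ≤deg , t≤τ̄ , (S , ∣S∣≡k , sequentialThreshold-isDynMono G S) ,
    λ j (D , ∣D∣≡j , dynMono) → k≤Pβ j (D , ∣D∣≡j , dynMono⇒nt-m≤coveredEdges G τ≤deg t≤τ̄ dynMono)
    where
    τ≤deg : IsThreshold G (sequentialThreshold G S)
    τ≤deg = sequentialThreshold-isThreshold G S
    t≤τ̄ : t ℚ.≤ average (sequentialThreshold G S)
    t≤τ̄ = nt-m≤coveredEdges⇒t≤sequential-average G S covers
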